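{- Let $P=(X,\le)$ be a poset and $\mathcal{M}$ a collection of subsets of $X$ containing all singletons. Then $P$ is $\mathcal{M}$-continuous if and only if for every $y\in X$ there is $M\in\mathcal{M}_\vee$ with $M\subseteq\twoheaddownarrow_{\mathcal{M}} y$ and $y\le\bigvee M$.
   Context: $\mathcal{M}_\vee$ is the set of members of $\mathcal{M}$ with a supremum; $\mathcal{M}^\wedge=\{\downarrow M:M\in\mathcal{M}\}$. $x\ll_{\mathcal{M}} y$ iff for all $M\in\mathcal{M}_\vee$, $y\le\bigvee M$ implies $x\in\downarrow M$; $\twoheaddownarrow_{\mathcal{M}} y=\{x:x\ll_{\mathcal{M}} y\}$. $P$ is $\mathcal{M}$-continuous if for every $y$, $\twoheaddownarrow_{\mathcal{M}} y\in\mathcal{M}^\wedge$ and $y=\bigvee\twoheaddownarrow_{\mathcal{M}} y$. -}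

module Defs where

open import Level using (Level; _⊔_; suc)
open import Data.Product using (Σ; ∃; _×_; _,_)
open import Relation.Binary.Core using (Rel)
open import Relation.Binary.PropositionalEquality using (_≡_)
open import Relation.Binary.Structures using (IsPartialOrder)

-- A poset P = (X, ≤): a partial order on X w.r.t. propositional equality.
-- Subsets of X are predicates X → Set a; a collection 𝓜 of subsets is a
-- predicate on such subsets.
module MContinuity {a ℓ b : Level} {X : Set a} (_≤_ : Rel X ℓ)
                   (𝓜 : (X → Set a) → Set b) where

  _⊆_ : ∀ {p q} → (X → Set p) → (X → Set q) → Set (a ⊔ p ⊔ q)
  A ⊆ B = ∀ x → A x → B x

  _≐_ : ∀ {p q} → (X → Set p) → (X → Set q) → Set (a ⊔ p ⊔ q)
  A ≐ B = (A ⊆ B) × (B ⊆ A)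

  IsSup : ∀ {p} → (X → Set p) → X → Set (a ⊔ p ⊔ ℓ)
  IsSup A s = (∀ m → A m → m ≤ s) × (∀ u → (∀ m → A m → m ≤ u) → s ≤ u)

  ↓_ : ∀ {p} → (X → Set p) → X → Set (a ⊔ p ⊔ ℓ)
  (↓ A) x = ∃ λ m → A m × (x ≤ m)

  _≪_ : X → X → Set (Level.suc a ⊔ b ⊔ ℓ)
  x ≪ y = ∀ (M : X → Set a) → 𝓜 M → ∀ s → IsSup M s → y ≤ s → (↓ M) x

  ↡ : X → X → Set (Level.suc a ⊔ b ⊔ ℓ)
  ↡ y x = x ≪ y

  In𝓜∧ : ∀ {p} → (X → Set p) → Set (Level.suc a ⊔ b ⊔ p ⊔ ℓ)
  In𝓜∧ D = Σ (X → Set a) λ M → 𝓜 M × (D ≐ (↓ M))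

  MContinuous : Set (Level.suc a ⊔ b ⊔ ℓ)
  MContinuous = ∀ y → In𝓜∧ (↡ y) × IsSup (↡ y) y

  ContainsSingletons : Set (a ⊔ b)
  ContainsSingletons = ∀ x → 𝓜 (λ z → z ≡ x)

  Criterion : Set (Level.suc a ⊔ b ⊔ ℓ)
  Criterion = ∀ y → Σ (X → Set a) λ M → 𝓜 M ×
                (Σ X λ s → IsSup M s × (M ⊆ ↡ y) × (y ≤ s))

module Submission where

-- The proof rests on three facts about down-sets and the way-below relation:
--   * a set and its down-closure have the same upper bounds, hence the same
--     suprema, and suprema transfer along extensional equality of sets;
--   * ↡ y is a down-set, so ↓ M ⊆ ↡ y as soon as M ⊆ ↡ y;
--   * since singletons lie in 𝓜, x ≪ y implies x ≤ y.
-- (⇒) If ↡ y = ↓ M with M ∈ 𝓜 and ⋁ ↡ y = y, then M ⊆ ↓ M = ↡ y and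
--     ⋁ M = ⋁ ↓ M = y, so M itself witnesses the criterion.
-- (⇐) If M ⊆ ↡ y and y ≤ ⋁ M = s, then ↡ y ⊆ ↓ M by the definition of ≪
--     and ↓ M ⊆ ↡ y by down-closure; y is an upper bound of ↡ y because
--     ≪ implies ≤, and it is the least one because y ≤ s ≤ any upper bound.

open import Defs
open import Level using (Level)
open import Relation.Binary.Core using (Rel)
open import Relation.Binary.PropositionalEquality using (_≡_; refl)
open import Relation.Binary.Structures using (IsPartialOrder)
open import Function.Bundles using (_⇔_; mk⇔)
open import Data.Product using (_,_)

module Properties {a ℓ b : Level} {X : Set a} (_≤_ : Rel X ℓ)
                  (po : IsPartialOrder _≡_ _≤_) (𝓜 : (X → Set a) → Set b) where
  open MContinuity _≤_ 𝓜
  open IsPartialOrder po using (trans; reflexive)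

  ≤-refl : ∀ {x} → x ≤ x
  ≤-refl = reflexive refl

  ⊆-↓ : ∀ {p} (A : X → Set p) → A ⊆ (↓ A)
  ⊆-↓ A m m∈A = m , m∈A , ≤-refl

  -- A supremum of ↓ A is a supremum of A: both sets have the same upper bounds.
  IsSup-↓⇒ : ∀ {p} {A : X → Set p} {s : X} → IsSup (↓ A) s → IsSup A s
  IsSup-↓⇒ {A = A} (ub , lub) =
    (λ m m∈A → ub m (⊆-↓ A m m∈A)) ,
    (λ u ubA → lub u (λ { x (m , m∈A , x≤m) → trans x≤m (ubA m m∈A) }))

  IsSup-resp-≐ : ∀ {p q} {A : X → Set p} {B : X → Set q} {s : X} →
                 A ≐ B → IsSup A s → IsSup B s
  IsSup-resp-≐ (A⊆B , B⊆A) (ub , lub) =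
    (λ m m∈B → ub m (B⊆A m m∈B)) ,
    (λ u ubB → lub u (λ m m∈A → ubB m (A⊆B m m∈A)))

  ≪-downward : ∀ {x x′ y} → x ≤ x′ → x′ ≪ y → x ≪ y
  ≪-downward x≤x′ x′≪y N N∈𝓜 t supN y≤t with x′≪y N N∈𝓜 t supN y≤t
  ... | n , n∈N , x′≤n = n , n∈N , trans x≤x′ x′≤n

  ↓-⊆-↡ : ∀ {A : X → Set a} {y} → A ⊆ ↡ y → (↓ A) ⊆ ↡ y
  ↓-⊆-↡ A⊆↡y x (m , m∈A , x≤m) = ≪-downward x≤m (A⊆↡y m m∈A)

  ↡-⊆-↓ : ∀ {M y s} → 𝓜 M → IsSup M s → y ≤ s → ↡ y ⊆ (↓ M)
  ↡-⊆-↓ M∈𝓜 supM y≤s x x≪y = x≪y _ M∈𝓜 _ supM y≤s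

  IsSup-singleton : ∀ y → IsSup (λ z → z ≡ y) y
  IsSup-singleton y = (λ { m refl → ≤-refl }) , (λ u ub → ub y refl)

  -- With singletons in 𝓜, way-below implies below (test ≪ against {y}).
  ≪⇒≤ : ContainsSingletons → ∀ {x y} → x ≪ y → x ≤ y
  ≪⇒≤ sing {y = y} x≪y with x≪y _ (sing y) y (IsSup-singleton y) ≤-refl
  ... | .y , refl , x≤y = x≤y

lemma3p12 : {a ℓ b : Level} {X : Set a} (_≤_ : Rel X ℓ) → IsPartialOrder _≡_ _≤_ →
    (𝓜 : (X → Set a) → Set b) → MContinuity.ContainsSingletons _≤_ 𝓜 →
    (MContinuity.MContinuous _≤_ 𝓜 ⇔ MContinuity.Criterion _≤_ 𝓜)
lemma3p12 _≤_ po 𝓜 sing = mk⇔ continuous⇒criterion criterion⇒continuous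
  where
  open MContinuity _≤_ 𝓜
  open Properties _≤_ po 𝓜
  open IsPartialOrder po using (trans)

  continuous⇒criterion : MContinuous → Criterion
  continuous⇒criterion cont y with cont y
  ... | (M , M∈𝓜 , ↡y≐↓M@(_ , ↓M⊆↡y)) , sup↡y =
    M , M∈𝓜 , y , IsSup-↓⇒ (IsSup-resp-≐ ↡y≐↓M sup↡y) ,
    (λ m m∈M → ↓M⊆↡y m (⊆-↓ M m m∈M)) , ≤-refl

  criterion⇒continuous : Criterion → MContinuous
  criterion⇒continuous crit y with crit y
  ... | M , M∈𝓜 , s , supM@(_ , lubM) , M⊆↡y , y≤s =
    (M , M∈𝓜 , ↡-⊆-↓ M∈𝓜 supM y≤s , ↓-⊆-↡ M⊆↡y) ,
    (λ x x≪y → ≪⇒≤ sing x≪y) ,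
    (λ u ub → trans y≤s (lubM u (λ m m∈M → ub m (M⊆↡y m m∈M))))
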